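{- Let $G$ be a double tree with covering trees $T_1$ and $T_2$. Then for any vertex $v$ of $T_1$ there is a vertex $u$ of $T_2$ such that $\{u,v\}$ is a positive zero forcing set of $G$. Moreover, $\{T_1,T_2\}$ coincides with a minimal collection of forcing trees of $G$ (i.e. there is a positive zero forcing process from a positive zero forcing set of size $2$ whose forcing trees are $T_1$ and $T_2$).
   Context: All graphs are finite and simple. A graph is outerplanar if it has a planar embedding with all vertices on one face. A double tree is a connected outerplanar graph, which is not a tree, whose vertex set can be covered by two vertex-disjoint induced trees $T_1,T_2$ (the covering trees). Positive zero forcing: given a set $B$ of black vertices, let $W_1,\dots,W_m$ be the vertex sets of the components of $G\setminus B$; if $u\in B$ and $w$ is the only white neighbour of $u$ in the subgraph induced by $W_i\cup B$, then $u$ may force $w$ black. A positive zero forcing set is an initial black set from which repeated forcing blackens all vertices. The forcing tree rooted at an initial black vertex $r$ consists of all vertices reachable from $r$ by a sequence of forces, with edges $uw$ whenever $u$ forces $w$. -}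

module Defs where

open import Data.Nat using (ℕ)
open import Data.Bool using (Bool; true; false)
open import Data.Fin using (Fin; _<_)
open import Data.Fin.Subset using (Subset; _∈_; _∉_; _∪_; ⁅_⁆; ⊤; Nonempty)
open import Data.Fin.Permutation using (Permutation′; _⟨$⟩ʳ_)
open import Data.List using (List; []; _∷_; _++_; [_])
open import Data.List.Relation.Unary.All using (All)
open import Data.List.Relation.Unary.Linked using (Linked)
open import Data.List.Relation.Unary.Unique.Propositional using (Unique)
open import Data.List.Membership.Propositional using () renaming (_∈_ to _∈ₗ_)
open import Data.Product using (Σ; ∃; _×_; _,_)
open import Data.Sum using (_⊎_)
open import Relation.Binary.PropositionalEquality using (_≡_; _≢_)
open import Relation.Nullary using (¬_)

record Graph (n : ℕ) : Set where
  field
    adj     : Fin n → Fin n → Bool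
    adj-sym : ∀ x y → adj x y ≡ adj y x
    irrefl  : ∀ x → adj x x ≡ false

module _ {n : ℕ} (G : Graph n) where
  open Graph G

  Adj : Fin n → Fin n → Set
  Adj x y = adj x y ≡ true

  data PathIn (P : Fin n → Set) : Fin n → Fin n → Set where
    here : ∀ {x} → P x → PathIn P x x
    next : ∀ {x z y} → P x → Adj x z → PathIn P z y → PathIn P x y

  ConnectedOn : Subset n → Set
  ConnectedOn S = ∀ x y → x ∈ S → y ∈ S → PathIn (_∈ S) x y

  CycleIn : Subset n → Set
  CycleIn S = Σ (Fin n) λ v0 → Σ (Fin n) λ v1 → Σ (Fin n) λ v2 → Σ (List (Fin n)) λ rest →
    Unique (v0 ∷ v1 ∷ v2 ∷ rest) × All (_∈ S) (v0 ∷ v1 ∷ v2 ∷ rest)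
    × Linked Adj ((v0 ∷ v1 ∷ v2 ∷ rest) ++ [ v0 ])

  InducedTree : Subset n → Set
  InducedTree S = Nonempty S × ConnectedOn S × ¬ CycleIn S

  Connected : Set
  Connected = ConnectedOn ⊤

  IsTree : Set
  IsTree = InducedTree ⊤

  -- outerplanar: vertices can be placed on a circle (cyclic order given by a
  -- permutation π) so that no two edges cross as chords.
  Outerplanar : Set
  Outerplanar = Σ (Permutation′ n) λ π → ∀ a b c d → Adj a b → Adj c d →
    ¬ ((π ⟨$⟩ʳ a) < (π ⟨$⟩ʳ c) × (π ⟨$⟩ʳ c) < (π ⟨$⟩ʳ b) × (π ⟨$⟩ʳ b) < (π ⟨$⟩ʳ d))

  DoubleTree : Subset n → Subset n → Set
  DoubleTree T1 T2 = Connected × Outerplanar × ¬ IsTree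
    × (∀ x → x ∈ T1 → x ∉ T2) × (∀ x → x ∈ T1 ⊎ x ∈ T2)
    × InducedTree T1 × InducedTree T2

  WhiteConn : Subset n → Fin n → Fin n → Set
  WhiteConn B = PathIn (_∉ B)

  -- positive zero forcing rule: u ∈ B forces w when w is the unique white
  -- neighbour of u in the subgraph induced by W ∪ B, W the component of G \ B
  -- containing w
  Force : Subset n → Fin n → Fin n → Set
  Force B u w = u ∈ B × w ∉ B × Adj u w
    × (∀ w' → Adj u w' → w' ∉ B → WhiteConn B w w' → w' ≡ w)

  data Run : Subset n → List (Fin n × Fin n) → Subset n → Set where
    done : ∀ {B} → Run B [] B
    step : ∀ {B B' u w fs} → Force B u w → Run (B ∪ ⁅ w ⁆) fs B' →
           Run B ((u , w) ∷ fs) B'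

  IsPZFSet : Subset n → Set
  IsPZFSet B = ∃ λ fs → Run B fs ⊤

  data Reach (fs : List (Fin n × Fin n)) (r : Fin n) : Fin n → Set where
    root : Reach fs r r
    forced : ∀ {u w} → Reach fs r u → (u , w) ∈ₗ fs → Reach fs r w

  ForceEdge : List (Fin n × Fin n) → Fin n → Fin n → Fin n → Set
  ForceEdge fs r u w = Reach fs r u × (u , w) ∈ₗ fs

  ForcingTreeIs : List (Fin n × Fin n) → Fin n → Subset n → Set
  ForcingTreeIs fs r T =
    (∀ x → (Reach fs r x → x ∈ T) × (x ∈ T → Reach fs r x))
    × (∀ x y → ((x ∈ T × y ∈ T × Adj x y) → (ForceEdge fs r x y ⊎ ForceEdge fs r y x))
             × ((ForceEdge fs r x y ⊎ ForceEdge fs r y x) → (x ∈ T × y ∈ T × Adj x y)))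

{-# OPTIONS --safe #-}

-- Draw G with its vertices on a circle and no two edges crossing. Two disjoint connected
-- sets cannot interleave on the circle, so T1 and T2 occupy complementary arcs. Call
-- black vertices p ∈ T1 and q ∈ T2 anchored if every edge crossing the chord pq lies in
-- T1. Every v ∈ T1 is anchored with a suitable u ∈ T2, and as long as a vertex is white
-- an anchored pair yields a force inside T1 or inside T2: let st be the outermost edge
-- crossing pq; if s or t is black, its chord to q is crossed by no edge, and otherwise
-- the last black vertex on a T1-path from p out of the pocket under st forces into it.
-- No edge leaves either side of a chord crossed by no edge; on a side containing a white
-- vertex a force is found by induction on the width of that side, reflecting the picture
-- whenever the far end of the chord has an inner neighbour in the near tree. As every
-- force stays inside T1 or inside T2 and both are acyclic, the forcing trees of the two
-- initial vertices are T1 and T2.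

module Submission where

open import Defs
open import Data.Nat using (ℕ)
open import Data.Fin using (Fin)
open import Data.Fin.Subset using (Subset; _∈_; _∪_; ⁅_⁆; ⊤)
open import Data.Product using (Σ; ∃; _×_; _,_)
open import Relation.Binary.PropositionalEquality using (_≢_)

open import Level using (0ℓ)
open import Data.Bool using (true)
import Data.Bool.Properties as Bool
open import Data.Nat using (suc; _+_; _∸_; _≤_; _<_; _≤?_; _<?_; s≤s)
open import Data.Nat.Properties
  using ( ≤-refl; ≤-trans; <-trans; <-asym; <-irrefl; <-≤-trans; <-cmp; <⇒≤; <⇒≢; <⇒≱; ≰⇒>; ≮⇒≥
        ; ≤∧≢⇒<; ≤-pred; n<1+n; m≤m+n; m≤n+m; +-monoˡ-<; +-cancelʳ-<; +-cancelʳ-≡; m∸n≤m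
        ; ∸-monoˡ-<; ∸-monoʳ-<; ∸-cancelʳ-<; ∸-cancelˡ-≡; m∸n+n≡m; +-∸-assoc; m+n∸m≡n )
open import Data.Fin using (toℕ)
open import Data.Fin.Properties using (any?; _≟_; toℕ<n; toℕ-injective)
open import Data.Fin.Permutation using (_⟨$⟩ʳ_)
open import Data.Fin.Subset using (_∉_; _⊂_; ∁; Nonempty)
open import Data.Fin.Subset.Properties
  using ( _∈?_; nonempty?; ⊆-antisym; ⊆⊤; ∈⊤; x∉∁p⇒x∈p; x∈∁p⇒x∉p
        ; p⊆p∪q; q⊆p∪q; x∈p∪q⁻; ∪-comm; x∈⁅x⁆; x∈⁅y⁆⇒x≡y )
open import Data.Fin.Subset.Induction using (⊃-wellFounded; Acc; acc)
open import Data.Product using (∃₂; proj₁; proj₂)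
open import Data.Sum using (_⊎_; inj₁; inj₂; swap; [_,_]′)
import Data.Sum as Sum
open import Data.Empty using (⊥-elim)
open import Data.List using (List; []; _∷_; filter; allFin)
open import Data.List.Properties using (∷-injectiveʳ; ∷ʳ-injective)
open import Data.List.Extrema.Nat using (argmin; argmax; argmin-all; argmax-all; f[argmin]≤f[xs]; f[xs]≤f[argmax])
open import Data.List.Relation.Unary.All as All using (All; []; _∷_; lookup)
open import Data.List.Relation.Unary.All.Properties using (¬Any⇒All¬; all-filter)
open import Data.List.Relation.Unary.Any using (here; there)
open import Data.List.Relation.Unary.AllPairs using ([]; _∷_)
open import Data.List.Relation.Unary.Linked using (Linked; [-]; _∷_)
open import Data.List.Relation.Unary.Unique.Propositional using (Unique)
open import Data.List.Membership.Propositional using () renaming (_∈_ to _∈ₗ_)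
open import Data.List.Membership.Propositional.Properties using (∈-filter⁺; ∈-allFin)
import Data.List.Membership.DecPropositional as DecMembership
open import Function using (_∘_; _⇔_; mk⇔)
open import Function.Bundles using (Equivalence; Injection)
open import Function.Properties.Inverse using (↔⇒↣)
open import Relation.Nullary using (¬_; Dec; yes; no)
open import Relation.Nullary.Decidable using (_×-dec_; _⊎-dec_; toSum)
open import Relation.Unary using (Pred; Decidable; _⊆_; _∩_)
open import Relation.Binary.Definitions using (tri<; tri≈; tri>)
open import Relation.Binary.PropositionalEquality
  using (_≡_; refl; sym; trans; cong; subst; subst₂; module ≡-Reasoning)

module Search {n : ℕ} {P : Pred (Fin n) 0ℓ} (P? : Decidable P) (f : Fin n → ℕ) where

  candidates : List (Fin n)
  candidates = filter P? (allFin n)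

  candidate : ∀ {y} → P y → y ∈ₗ candidates
  candidate = ∈-filter⁺ P? (∈-allFin _)

  minimiser : ∀ {x} → P x → ∃ λ m → P m × ∀ {y} → P y → f m ≤ f y
  minimiser {x} px = argmin f x candidates , argmin-all f px (all-filter P? (allFin n))
                   , lookup (f[argmin]≤f[xs] x candidates) ∘ candidate

  maximiser : ∀ {x} → P x → ∃ λ m → P m × ∀ {y} → P y → f y ≤ f m
  maximiser {x} px = argmax f x candidates , argmax-all f px (all-filter P? (allFin n))
                   , lookup (f[xs]≤f[argmax] x candidates) ∘ candidate

open Search using (minimiser; maximiser)

∈-∪⁅⁆⁻ : ∀ {n} {B : Subset n} {x w} → x ∈ B ∪ ⁅ w ⁆ → x ∈ B ⊎ x ≡ w
∈-∪⁅⁆⁻ {B = B} {w = w} = Sum.map₂ (x∈⁅y⁆⇒x≡y w) ∘ x∈p∪q⁻ B ⁅ w ⁆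

B⊂B∪⁅w⁆ : ∀ {n} {B : Subset n} {w} → w ∉ B → B ⊂ B ∪ ⁅ w ⁆
B⊂B∪⁅w⁆ {B = B} {w} w∉B = p⊆p∪q ⁅ w ⁆ , w , q⊆p∪q B ⁅ w ⁆ (x∈⁅x⁆ w) , w∉B

∈-⁅⁆∪⁅⁆⁻ : ∀ {n} {x v u : Fin n} → x ∈ ⁅ v ⁆ ∪ ⁅ u ⁆ → x ≡ v ⊎ x ≡ u
∈-⁅⁆∪⁅⁆⁻ {v = v} = Sum.map₁ (x∈⁅y⁆⇒x≡y v) ∘ ∈-∪⁅⁆⁻

module Paths {n : ℕ} (G : Graph n) where

  open Graph G

  Adj-sym : ∀ {x y} → Adj G x y → Adj G y x
  Adj-sym {x} {y} xy = trans (adj-sym y x) xy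

  Adj-irrefl : ∀ {x} → ¬ Adj G x x
  Adj-irrefl {x} xx with () ← trans (sym xx) (irrefl x)

  Adj? : ∀ x y → Dec (Adj G x y)
  Adj? x y = adj x y Bool.≟ true

  module Path where

    module _ {P : Pred (Fin n) 0ℓ} where

      source : ∀ {a b} → PathIn G P a b → P a
      source (here pa)     = pa
      source (next pa _ _) = pa

      target : ∀ {a b} → PathIn G P a b → P b
      target (here pb)    = pb
      target (next _ _ w) = target w

      _++_ : ∀ {a b c} → PathIn G P a b → PathIn G P b c → PathIn G P a c
      here _      ++ w′ = w′
      next pa e w ++ w′ = next pa e (w ++ w′)

      _∷ʳ_ : ∀ {a b c} → PathIn G P a b → Adj G b c × P c → PathIn G P a c
      here pb     ∷ʳ (e , pc) = next pb e (here pc)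
      next pa e w ∷ʳ last     = next pa e (w ∷ʳ last)

      reverse : ∀ {a b} → PathIn G P a b → PathIn G P b a
      reverse (here pa)     = here pa
      reverse (next pa e w) = reverse w ∷ʳ (Adj-sym e , pa)

    map : ∀ {P Q : Pred (Fin n) 0ℓ} → P ⊆ Q → ∀ {a b} → PathIn G P a b → PathIn G Q a b
    map f (here pa)     = here (f pa)
    map f (next pa e w) = next (f pa) e (map f w)

  open Path public using (source; target)

  module _ {S P : Pred (Fin n) 0ℓ} where

    propagate : ∀ {a b} → PathIn G S a b → P a →
                (∀ {c d} → P c → S c → Adj G c d → S d → P d) → PathIn G (S ∩ P) a b
    propagate (here sa)     pa closed = here (sa , pa)
    propagate (next sa e w) pa closed = next (sa , pa) e (propagate w (closed pa sa e (source w)) closed)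

    propagate-target : ∀ {a b} → PathIn G S a b → P a →
                       (∀ {c d} → P c → S c → Adj G c d → S d → P d) → P b
    propagate-target w pa closed = proj₂ (target (propagate w pa closed))

    first-exit : ∀ {E : Pred (Fin n) 0ℓ} {a b} → PathIn G S a b → P a →
                 (∀ {c d} → P c → S c → Adj G c d → S d → P d ⊎ E d) →
                 PathIn G (S ∩ P) a b
                 ⊎ ∃₂ λ c e → PathIn G (S ∩ P) a c × Adj G c e × E e × S e
    first-exit (here sa) pa closed = inj₁ (here (sa , pa))
    first-exit (next sa e w) pa closed with closed pa sa e (source w)
    ... | inj₂ ed = inj₂ (_ , _ , here (sa , pa) , e , ed , source w)
    ... | inj₁ pd with first-exit w pd closed
    ...   | inj₁ w′                          = inj₁ (next (sa , pa) e w′)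
    ...   | inj₂ (c , d , w′ , cd , ed , sd) = inj₂ (c , d , next (sa , pa) e w′ , cd , ed , sd)

  module _ {S Q : Pred (Fin n) 0ℓ} (Q? : Decidable Q) where

    first-entry : ∀ {a b} → PathIn G S a b → ¬ Q a → Q b →
                  ∃₂ λ c e → PathIn G (λ v → S v × ¬ Q v) a c × Adj G c e × Q e × S e
    first-entry w ¬qa qb with first-exit w ¬qa (λ {_} {d} _ _ _ _ → swap (toSum (Q? d)))
    ... | inj₁ w′   = ⊥-elim (proj₂ (target w′) qb)
    ... | inj₂ exit = exit

    last-exit : ∀ {a b} → PathIn G S a b → Q a → ¬ Q b →
                ∃₂ λ x y → Q x × S x × Adj G x y × PathIn G (λ v → S v × ¬ Q v) y b
    last-exit w qa ¬qb with first-entry (Path.reverse w) ¬qb qa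
    ... | c , e , w′ , ce , qe , se = e , c , qe , se , Adj-sym ce , Path.reverse w′

module Acyclicity {n : ℕ} (G : Graph n) where

  open import Data.List using (_++_; [_])
  open Paths G
  open DecMembership (_≟_ {n}) using () renaming (_∈?_ to _∈ₗ?_)

  -- x is the vertex that will close the path into a cycle
  record IsSimplePath (P : Pred (Fin n) 0ℓ) (vs : List (Fin n)) (b x : Fin n) : Set where
    field
      unique : Unique vs
      inside : All P vs
      linked : Linked (Adj G) (vs ++ [ x ])
      ends   : ∃ λ init → vs ≡ init ++ [ b ]

  open IsSimplePath

  module _ {P : Pred (Fin n) 0ℓ} {b x : Fin n} where

    drop-first : ∀ {a c cs} → IsSimplePath P (a ∷ c ∷ cs) b x → IsSimplePath P (c ∷ cs) b x
    drop-first sp with _ ∷ us ← unique sp | _ ∷ ps ← inside sp | _ ∷ l ← linked sp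
                     | _ ∷ init , eq ← ends sp
      = record { unique = us ; inside = ps ; linked = l ; ends = init , ∷-injectiveʳ eq }

    cut-at : ∀ {a vs} → a ∈ₗ vs → IsSimplePath P vs b x → ∃ λ rest → IsSimplePath P (a ∷ rest) b x
    cut-at (here refl)            sp = _ , sp
    cut-at (there {xs = _ ∷ _} m) sp = cut-at m (drop-first sp)

    loop-erase : ∀ {a} → Adj G b x → PathIn G P a b → ∃ λ rest → IsSimplePath P (a ∷ rest) b x
    loop-erase bx (here pb) = [] , record
      { unique = [] ∷ [] ; inside = pb ∷ [] ; linked = bx ∷ [-] ; ends = [] , refl }
    loop-erase {a} bx (next pa ac w) with loop-erase bx w
    ... | rest , sp with a ∈ₗ? (_ ∷ rest)
    ...   | yes a∈ = cut-at a∈ sp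
    ...   | no a∉ = _ ∷ rest , record
      { unique = ¬Any⇒All¬ _ a∉ ∷ unique sp
      ; inside = pa ∷ inside sp
      ; linked = ac ∷ linked sp
      ; ends   = a ∷ proj₁ (ends sp) , cong (a ∷_) (proj₂ (ends sp)) }

  no-bypass : ∀ {T : Subset n} → ¬ CycleIn G T → ∀ {x y z} → x ∈ T → y ≢ z →
              Adj G x y → Adj G x z → ¬ PathIn G (λ v → v ∈ T × v ≢ x) y z
  no-bypass acyclic xT y≢z xy xz w with loop-erase (Adj-sym xz) w
  ... | [] , sp = y≢z (proj₂ (∷ʳ-injective [] _ (proj₂ (ends sp))))
  ... | r ∷ rest , sp = acyclic (_ , _ , r , rest ,
        (All.map (λ pv x≡v → proj₂ pv (sym x≡v)) (inside sp) ∷ unique sp) ,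
        (xT ∷ All.map proj₁ (inside sp)) , xy ∷ linked sp)

module Forcing {n : ℕ} (G : Graph n) where

  open Paths G
  open Acyclicity G

  black≢white : ∀ {B : Subset n} {x v} → x ∈ B → v ∉ B → v ≢ x
  black≢white x∈B v∉B refl = v∉B x∈B

  ForceWithin : Subset n → Subset n → Set
  ForceWithin B Z = ∃₂ λ x c → Force G B x c × x ∈ Z × c ∈ Z

  WhiteClosed : Subset n → Pred (Fin n) 0ℓ → Set
  WhiteClosed B R = ∀ {c d} → R c → c ∉ B → Adj G c d → d ∉ B → R d

  -- The force is the first black vertex of a path in Z from w to b; any second white
  -- neighbour in the same white component would close a cycle inside R ⊆ Z.
  trapped-white⇒force : ∀ {Z B : Subset n} {R : Pred (Fin n) 0ℓ} → ¬ CycleIn G Z → ConnectedOn G Z →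
                        R ⊆ (_∈ Z) → WhiteClosed B R →
                        ∀ {w b} → w ∉ B → R w → b ∈ B → b ∈ Z → ForceWithin B Z
  trapped-white⇒force {B = B} {R} acyclic connected R⊆Z closed {w} w∉B Rw b∈B b∈Z
    with first-entry (_∈? B) (connected w _ (R⊆Z Rw) b∈Z) w∉B b∈B
  ... | c , x , w→c , cx , x∈B , x∈Z = x , c , (x∈B , c∉B , Adj-sym cx , unique) , x∈Z , R⊆Z Rc
    where
    Rc : R c
    Rc = propagate-target w→c Rw (λ Rc′ (_ , c′∉B) e (_ , d∉B) → closed Rc′ c′∉B e d∉B)
    c∉B : c ∉ B
    c∉B = proj₂ (target w→c)
    unique : ∀ w′ → Adj G x w′ → w′ ∉ B → WhiteConn G B c w′ → w′ ≡ c
    unique w′ xw′ w′∉B c→w′ with w′ ≟ c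
    ... | yes w′≡c = w′≡c
    ... | no w′≢c = ⊥-elim (no-bypass acyclic x∈Z (w′≢c ∘ sym) (Adj-sym cx) xw′
            (Path.map (λ (v∉B , Rv) → R⊆Z Rv , black≢white x∈B v∉B)
                      (propagate c→w′ Rc (λ Rv v∉B e d∉B → closed Rv v∉B e d∉B))))

  forced-adjacent : ∀ {B B′ fs u w} → Run G B fs B′ → (u , w) ∈ₗ fs → Adj G u w
  forced-adjacent (step (_ , _ , uw , _) _) (here refl) = uw
  forced-adjacent (step _ run)              (there m)   = forced-adjacent run m

  run-induction : ∀ {B B′ fs} (I : Subset n → Set) → Run G B fs B′ → I B →
                  (∀ {C u w} → (u , w) ∈ₗ fs → Force G C u w → I C → I (C ∪ ⁅ w ⁆)) → I B′
  run-induction I done         i _        = i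
  run-induction I (step f run) i preserve = run-induction I run (preserve (here refl) f i) (preserve ∘ there)

  module Greedy {Inv : Subset n → Set} {Ok : Fin n × Fin n → Set}
                (grow : ∀ {B} w → Inv B → Inv (B ∪ ⁅ w ⁆))
                (force : ∀ {B w} → Inv B → w ∉ B → ∃₂ λ u v → Force G B u v × Ok (u , v)) where

    complete-run : ∀ {B} → Inv B → ∃ λ fs → Run G B fs ⊤ × All Ok fs
    complete-run {B} = go (⊃-wellFounded B)
      where
      go : ∀ {B} → Acc _ B → Inv B → ∃ λ fs → Run G B fs ⊤ × All Ok fs
      go {B} (acc larger) inv with nonempty? (∁ B)
      ... | no all-black = [] , subst (λ C → Run G C [] ⊤) (sym B≡⊤) done , []
        where
        B≡⊤ : B ≡ ⊤
        B≡⊤ = ⊆-antisym ⊆⊤ (λ {x} _ → x∉∁p⇒x∈p (λ x∈∁B → all-black (x , x∈∁B)))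
      ... | yes (w , w∈∁B)
        with u , v , f@(_ , v∉B , _) , ok ← force inv (x∈∁p⇒x∉p w∈∁B)
        with fs , run , oks ← go (larger (B⊂B∪⁅w⁆ v∉B)) (grow v inv)
        = (u , v) ∷ fs , step f run , ok ∷ oks

  module ForcingTree {T : Subset n} (acyclic : ¬ CycleIn G T) {B₀ fs} (run : Run G B₀ fs ⊤)
                     {r} (r∈T : r ∈ T) (B₀∩T⊆r : ∀ {x} → x ∈ B₀ → x ∈ T → x ≡ r)
                     (respects : ∀ {u w} → (u , w) ∈ₗ fs → u ∈ T ⇔ w ∈ T) where

    open Equivalence

    reach⇒∈ : ∀ {x} → Reach G fs r x → x ∈ T
    reach⇒∈ root          = r∈T
    reach⇒∈ (forced ru m) = to (respects m) (reach⇒∈ ru)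

    ReachedWhenBlack : Subset n → Set
    ReachedWhenBlack B = ∀ {x} → x ∈ B → x ∈ T → Reach G fs r x

    ∈⇒reach : ∀ {x} → x ∈ T → Reach G fs r x
    ∈⇒reach = run-induction ReachedWhenBlack run
                (λ x∈B₀ x∈T → subst (Reach G fs r) (sym (B₀∩T⊆r x∈B₀ x∈T)) root) preserve ∈⊤
      where
      preserve : ∀ {B u w} → (u , w) ∈ₗ fs → Force G B u w →
                 ReachedWhenBlack B → ReachedWhenBlack (B ∪ ⁅ w ⁆)
      preserve m (u∈B , _) reached x∈B′ x∈T with ∈-∪⁅⁆⁻ x∈B′
      ... | inj₁ x∈B = reached x∈B x∈T
      ... | inj₂ refl = forced (reached u∈B (from (respects m) x∈T)) m

    BlackTreeConnected BlackEdgesForced : Subset n → Set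
    BlackTreeConnected B = ∀ {x} → x ∈ B → x ∈ T → PathIn G (λ z → z ∈ B × z ∈ T) r x
    BlackEdgesForced B = ∀ {x y} → x ∈ B → y ∈ B → x ∈ T → y ∈ T → Adj G x y →
                         (x , y) ∈ₗ fs ⊎ (y , x) ∈ₗ fs

    edges-forced : ∀ {x y} → x ∈ T → y ∈ T → Adj G x y → (x , y) ∈ₗ fs ⊎ (y , x) ∈ₗ fs
    edges-forced = proj₁ (run-induction (λ B → BlackEdgesForced B × BlackTreeConnected B) run
                            (initial-edges , initial-connected) preserve) ∈⊤ ∈⊤
      where
      initial-edges : BlackEdgesForced B₀
      initial-edges x∈B₀ y∈B₀ x∈T y∈T xy
        with refl ← B₀∩T⊆r x∈B₀ x∈T | refl ← B₀∩T⊆r y∈B₀ y∈T = ⊥-elim (Adj-irrefl xy)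
      initial-connected : BlackTreeConnected B₀
      initial-connected x∈B₀ x∈T with refl ← B₀∩T⊆r x∈B₀ x∈T = here (x∈B₀ , x∈T)
      preserve : ∀ {B u w} → (u , w) ∈ₗ fs → Force G B u w →
                 BlackEdgesForced B × BlackTreeConnected B →
                 BlackEdgesForced (B ∪ ⁅ w ⁆) × BlackTreeConnected (B ∪ ⁅ w ⁆)
      preserve {B} {u} {w} m (u∈B , w∉B , uw , _) (forced-edges , connected) = edges′ , connected′
        where
        grow : ∀ {x} → PathIn G (λ z → z ∈ B × z ∈ T) r x →
                       PathIn G (λ z → z ∈ B ∪ ⁅ w ⁆ × z ∈ T) r x
        grow = Path.map (λ (z∈B , z∈T) → p⊆p∪q ⁅ w ⁆ z∈B , z∈T)
        connected′ : BlackTreeConnected (B ∪ ⁅ w ⁆)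
        connected′ x∈B′ x∈T with ∈-∪⁅⁆⁻ x∈B′
        ... | inj₁ x∈B = grow (connected x∈B x∈T)
        ... | inj₂ refl = grow (connected u∈B (from (respects m) x∈T)) Path.∷ʳ (uw , x∈B′ , x∈T)
        -- a second black tree neighbour x of w would give a bypass u ⋯ r ⋯ x of w
        into-w : ∀ {x} → x ∈ B → x ∈ T → w ∈ T → Adj G x w → (x , w) ∈ₗ fs
        into-w {x} x∈B x∈T w∈T xw with x ≟ u
        ... | yes refl = m
        ... | no x≢u = ⊥-elim (no-bypass acyclic w∈T (x≢u ∘ sym) (Adj-sym uw) (Adj-sym xw)
                (Path.map (λ (z∈B , z∈T) → z∈T , black≢white z∈B w∉B ∘ sym)
                          (Path.reverse (connected u∈B (from (respects m) w∈T)) Path.++ connected x∈B x∈T)))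
        edges′ : BlackEdgesForced (B ∪ ⁅ w ⁆)
        edges′ x∈B′ y∈B′ x∈T y∈T xy with ∈-∪⁅⁆⁻ x∈B′ | ∈-∪⁅⁆⁻ y∈B′
        ... | inj₁ x∈B | inj₁ y∈B = forced-edges x∈B y∈B x∈T y∈T xy
        ... | inj₁ x∈B | inj₂ refl = inj₁ (into-w x∈B x∈T y∈T xy)
        ... | inj₂ refl | inj₁ y∈B = inj₂ (into-w y∈B y∈T x∈T (Adj-sym xy))
        ... | inj₂ refl | inj₂ refl = ⊥-elim (Adj-irrefl xy)

    forcing-tree : ForcingTreeIs G fs r T
    forcing-tree = (λ x → reach⇒∈ , ∈⇒reach)
                 , λ x y → (λ (x∈T , y∈T , xy) →
                               Sum.map (∈⇒reach x∈T ,_) (∈⇒reach y∈T ,_) (edges-forced x∈T y∈T xy))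
                         , λ { (inj₁ (rx , m)) →
                                 reach⇒∈ rx , to (respects m) (reach⇒∈ rx) , forced-adjacent run m
                             ; (inj₂ (ry , m)) →
                                 to (respects m) (reach⇒∈ ry) , reach⇒∈ ry , Adj-sym (forced-adjacent run m) }


-- vertices on a circle, listed from a cut point
record Layout (n : ℕ) : Set where
  field
    pos           : Fin n → ℕ
    bound         : ℕ
    pos<bound     : ∀ x → pos x < bound
    pos-injective : ∀ {x y} → pos x ≡ pos y → x ≡ y

open Layout

module _ {n : ℕ} (L : Layout n) where

  data Cyclic (x y z : Fin n) : Set where
    x<y<z : pos L x < pos L y → pos L y < pos L z → Cyclic x y z
    y<z<x : pos L y < pos L z → pos L z < pos L x → Cyclic x y z
    z<x<y : pos L z < pos L x → pos L x < pos L y → Cyclic x y z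

  Separates : Fin n → Fin n → Fin n → Fin n → Set
  Separates a b c d = Cyclic a c b × Cyclic b d a

  Between : Fin n → Fin n → Fin n → Set
  Between a b x = pos L a < pos L x × pos L x < pos L b

  between? : ∀ a b x → Dec (Between a b x)
  between? a b x = (pos L a <? pos L x) ×-dec (pos L x <? pos L b)

  First : Fin n → Set
  First r = ∀ x → x ≢ r → pos L r < pos L x

module _ {n : ℕ} {L : Layout n} where

  compare : ∀ x y → pos L x < pos L y ⊎ x ≡ y ⊎ pos L y < pos L x
  compare x y with <-cmp (pos L x) (pos L y)
  ... | tri< lt _ _ = inj₁ lt
  ... | tri≈ _ eq _ = inj₂ (inj₁ (pos-injective L eq))
  ... | tri> _ _ gt = inj₂ (inj₂ gt)

  cyclic-shift : ∀ {x y z} → Cyclic L x y z → Cyclic L y z x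
  cyclic-shift (x<y<z xy yz) = z<x<y xy yz
  cyclic-shift (y<z<x yz zx) = x<y<z yz zx
  cyclic-shift (z<x<y zx xy) = y<z<x zx xy

  separates-sym : ∀ {a b c d} → Separates L a b c d → Separates L b a d c
  separates-sym (acb , bda) = bda , acb

  not-before-first : ∀ {r x} → First L r → ¬ pos L x < pos L r
  not-before-first {r} {x} first xr with x ≟ r
  ... | yes refl = <-irrefl refl xr
  ... | no x≢r   = <-asym xr (first x x≢r)

  cyclic-from-first : ∀ {r x y} → First L r → Cyclic L r x y → pos L x < pos L y
  cyclic-from-first first (x<y<z _ xy) = xy
  cyclic-from-first first (y<z<x _ yr) = ⊥-elim (not-before-first first yr)
  cyclic-from-first first (z<x<y yr _) = ⊥-elim (not-before-first first yr)

  cyclic-repeat : ∀ {x y} → ¬ Cyclic L x x y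
  cyclic-repeat (x<y<z xx _) = <-irrefl refl xx
  cyclic-repeat (y<z<x xy yx) = <-asym xy yx
  cyclic-repeat (z<x<y _ xx) = <-irrefl refl xx

  separates-from-first : ∀ {p q c d} → First L q → Separates L p q c d →
                         Between L q p d × pos L p < pos L c
  separates-from-first {q = q} {d = d} first (pcq , qdp) with d ≟ q
  ... | yes refl = ⊥-elim (cyclic-repeat qdp)
  ... | no d≢q   = (first d d≢q , cyclic-from-first first qdp)
                 , cyclic-from-first first (cyclic-shift (cyclic-shift pcq))

  separates-from-positions : ∀ {p q c d} → pos L q < pos L d → pos L d < pos L p → pos L p < pos L c →
                             Separates L p q c d
  separates-from-positions qd dp pc = z<x<y (<-trans qd dp) pc , x<y<z qd dp

module Rotation {n : ℕ} (L : Layout n) (r : Fin n) where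

  High Low : Fin n → Set
  High x = pos L r ≤ pos L x
  Low  x = pos L x < pos L r

  side : ∀ x → High x ⊎ Low x
  side x with pos L r ≤? pos L x
  ... | yes h = inj₁ h
  ... | no ¬h = inj₂ (≰⇒> ¬h)

  not-high-and-low : ∀ {x} → High x → ¬ Low x
  not-high-and-low h l = <⇒≱ l h

  shifted : Fin n → ℕ
  shifted x with side x
  ... | inj₁ _ = pos L x
  ... | inj₂ _ = pos L x + bound L

  shifted-high : ∀ {x} → High x → shifted x ≡ pos L x
  shifted-high {x} h with side x
  ... | inj₁ _ = refl
  ... | inj₂ l = ⊥-elim (not-high-and-low h l)

  shifted-low : ∀ {x} → Low x → shifted x ≡ pos L x + bound L
  shifted-low {x} l with side x
  ... | inj₁ h = ⊥-elim (not-high-and-low h l)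
  ... | inj₂ _ = refl

  below-bound : ∀ x y → pos L x < pos L y + bound L
  below-bound x y = <-≤-trans (pos<bound L x) (m≤n+m (bound L) (pos L y))

  high-high : ∀ {x y} → High x → High y → pos L x < pos L y → shifted x < shifted y
  high-high hx hy = subst₂ _<_ (sym (shifted-high hx)) (sym (shifted-high hy))

  low-low : ∀ {x y} → Low x → Low y → pos L x < pos L y → shifted x < shifted y
  low-low lx ly lt = subst₂ _<_ (sym (shifted-low lx)) (sym (shifted-low ly)) (+-monoˡ-< (bound L) lt)

  high-low : ∀ {x y} → High x → Low y → shifted x < shifted y
  high-low {x} {y} hx ly = subst₂ _<_ (sym (shifted-high hx)) (sym (shifted-low ly)) (below-bound x y)

  shifted-<⁻ : ∀ {x y} → shifted x < shifted y →
               (High x × High y × pos L x < pos L y) ⊎ (Low x × Low y × pos L x < pos L y) ⊎ (High x × Low y)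
  shifted-<⁻ {x} {y} lt with side x | side y
  ... | inj₁ hx | inj₁ hy = inj₁ (hx , hy , lt)
  ... | inj₂ lx | inj₂ ly = inj₂ (inj₁ (lx , ly , +-cancelʳ-< (bound L) (pos L x) (pos L y) lt))
  ... | inj₁ hx | inj₂ ly = inj₂ (inj₂ (hx , ly))
  ... | inj₂ lx | inj₁ hy = ⊥-elim (<-asym (below-bound y x) lt)

  shifted-injective : ∀ {x y} → shifted x ≡ shifted y → x ≡ y
  shifted-injective {x} {y} eq with side x | side y
  ... | inj₁ _ | inj₁ _ = pos-injective L eq
  ... | inj₂ _ | inj₂ _ = pos-injective L (+-cancelʳ-≡ (bound L) (pos L x) (pos L y) eq)
  ... | inj₁ _ | inj₂ _ = ⊥-elim (<⇒≢ (below-bound x y) eq)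
  ... | inj₂ _ | inj₁ _ = ⊥-elim (<⇒≢ (below-bound y x) (sym eq))

  shifted<bound : ∀ x → shifted x < bound L + bound L
  shifted<bound x with side x
  ... | inj₁ _ = <-≤-trans (pos<bound L x) (m≤m+n (bound L) (bound L))
  ... | inj₂ _ = +-monoˡ-< (bound L) (pos<bound L x)

  rotated : Layout n
  rotated = record { pos = shifted ; bound = bound L + bound L
                   ; pos<bound = shifted<bound ; pos-injective = shifted-injective }

  rotated-first : First rotated r
  rotated-first x x≢r = [ (λ hx → high-high ≤-refl hx (≤∧≢⇒< hx (x≢r ∘ pos-injective L ∘ sym)))
                        , high-low ≤-refl ]′ (side x)

  ordered⇒cyclic⁺ : ∀ {x y z} → pos L x < pos L y → pos L y < pos L z → Cyclic rotated x y z
  ordered⇒cyclic⁺ {x} {y} {z} xy yz with side x | side y | side z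
  ... | inj₁ hx | inj₁ hy | inj₁ hz = x<y<z (high-high hx hy xy) (high-high hy hz yz)
  ... | inj₂ lx | inj₂ ly | inj₂ lz = x<y<z (low-low lx ly xy) (low-low ly lz yz)
  ... | inj₂ lx | inj₂ ly | inj₁ hz = z<x<y (high-low hz lx) (low-low lx ly xy)
  ... | inj₂ lx | inj₁ hy | inj₁ hz = y<z<x (high-high hy hz yz) (high-low hz lx)
  ... | inj₁ hx | inj₂ ly | _       = ⊥-elim (not-high-and-low (≤-trans hx (<⇒≤ xy)) ly)
  ... | _       | inj₁ hy | inj₂ lz = ⊥-elim (not-high-and-low (≤-trans hy (<⇒≤ yz)) lz)

  ordered⇒cyclic⁻ : ∀ {x y z} → shifted x < shifted y → shifted y < shifted z → Cyclic L x y z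
  ordered⇒cyclic⁻ xy yz with shifted-<⁻ xy | shifted-<⁻ yz
  ... | inj₁ (_ , _ , xy′)        | inj₁ (_ , _ , yz′)        = x<y<z xy′ yz′
  ... | inj₂ (inj₁ (_ , _ , xy′)) | inj₂ (inj₁ (_ , _ , yz′)) = x<y<z xy′ yz′
  ... | inj₁ (hx , _ , xy′)       | inj₂ (inj₂ (_ , lz))      = z<x<y (<-≤-trans lz hx) xy′
  ... | inj₂ (inj₂ (hx , _))      | inj₂ (inj₁ (_ , lz , yz′)) = y<z<x yz′ (<-≤-trans lz hx)
  ... | inj₁ (_ , hy , _)         | inj₂ (inj₁ (ly , _))      = ⊥-elim (not-high-and-low hy ly)
  ... | inj₂ (inj₁ (_ , ly , _))  | inj₁ (hy , _)             = ⊥-elim (not-high-and-low hy ly)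
  ... | inj₂ (inj₁ (_ , ly , _))  | inj₂ (inj₂ (hy , _))      = ⊥-elim (not-high-and-low hy ly)
  ... | inj₂ (inj₂ (_ , ly))      | inj₁ (hy , _)             = ⊥-elim (not-high-and-low hy ly)
  ... | inj₂ (inj₂ (_ , ly))      | inj₂ (inj₂ (hy , _))      = ⊥-elim (not-high-and-low hy ly)

  cyclic⁺ : ∀ {x y z} → Cyclic L x y z → Cyclic rotated x y z
  cyclic⁺ (x<y<z xy yz) = ordered⇒cyclic⁺ xy yz
  cyclic⁺ (y<z<x yz zx) = cyclic-shift (cyclic-shift (ordered⇒cyclic⁺ yz zx))
  cyclic⁺ (z<x<y zx xy) = cyclic-shift (ordered⇒cyclic⁺ zx xy)

  cyclic⁻ : ∀ {x y z} → Cyclic rotated x y z → Cyclic L x y z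
  cyclic⁻ (x<y<z xy yz) = ordered⇒cyclic⁻ xy yz
  cyclic⁻ (y<z<x yz zx) = cyclic-shift (cyclic-shift (ordered⇒cyclic⁻ yz zx))
  cyclic⁻ (z<x<y zx xy) = cyclic-shift (ordered⇒cyclic⁻ zx xy)

rotate : ∀ {n} → Layout n → Fin n → Layout n
rotate = Rotation.rotated

rotate-first : ∀ {n} (L : Layout n) r → First (rotate L r) r
rotate-first = Rotation.rotated-first

module _ {n : ℕ} {L : Layout n} {r : Fin n} where

  cyclic-rotate⁺ : ∀ {x y z} → Cyclic L x y z → Cyclic (rotate L r) x y z
  cyclic-rotate⁺ = Rotation.cyclic⁺ L r

  cyclic-rotate⁻ : ∀ {x y z} → Cyclic (rotate L r) x y z → Cyclic L x y z
  cyclic-rotate⁻ = Rotation.cyclic⁻ L r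

  separates-rotate⁺ : ∀ {a b c d} → Separates L a b c d → Separates (rotate L r) a b c d
  separates-rotate⁺ (acb , bda) = cyclic-rotate⁺ acb , cyclic-rotate⁺ bda

  separates-rotate⁻ : ∀ {a b c d} → Separates (rotate L r) a b c d → Separates L a b c d
  separates-rotate⁻ (acb , bda) = cyclic-rotate⁻ acb , cyclic-rotate⁻ bda

arc-split : ∀ {n} (L : Layout n) {p q w} → q ≢ p → w ≢ p → w ≢ q →
            Between (rotate L p) p q w ⊎ Between (rotate L q) q p w
arc-split L {p} {q} {w} q≢p w≢p w≢q with compare {L = rotate L p} w q
... | inj₁ wq         = inj₁ (rotate-first L p w w≢p , wq)
... | inj₂ (inj₁ w≡q) = ⊥-elim (w≢q w≡q)
... | inj₂ (inj₂ qw)  = inj₂ (rotate-first L q w w≢q , cyclic-from-first (rotate-first L q)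
      (cyclic-shift (cyclic-rotate⁺ {L = L} {r = q}
        (cyclic-rotate⁻ {L = L} {r = p} (x<y<z (rotate-first L p q q≢p) qw)))))

reflect : ∀ {n} → Layout n → Layout n
reflect L = record
  { pos           = λ x → bound L ∸ pos L x
  ; bound         = suc (bound L)
  ; pos<bound     = λ x → s≤s (m∸n≤m (bound L) (pos L x))
  ; pos-injective = λ {x} {y} eq → pos-injective L
      (∸-cancelˡ-≡ (<⇒≤ (pos<bound L x)) (<⇒≤ (pos<bound L y)) eq)
  }

module _ {n : ℕ} {L : Layout n} where

  reflect-<⁺ : ∀ {x y} → pos L x < pos L y → pos (reflect L) y < pos (reflect L) x
  reflect-<⁺ {y = y} lt = ∸-monoʳ-< lt (<⇒≤ (pos<bound L y))

  reflect-<⁻ : ∀ {x y} → pos (reflect L) x < pos (reflect L) y → pos L y < pos L x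
  reflect-<⁻ = ∸-cancelʳ-<

  reflect-distance : ∀ {x y} → pos L x ≤ pos L y →
                     pos (reflect L) x ∸ pos (reflect L) y ≡ pos L y ∸ pos L x
  reflect-distance {x} {y} x≤y = begin
    (N ∸ a) ∸ (N ∸ b)             ≡⟨ cong (λ m → m ∸ a ∸ (N ∸ b)) (sym (m∸n+n≡m b≤N)) ⟩
    ((N ∸ b) + b ∸ a) ∸ (N ∸ b)   ≡⟨ cong (_∸ (N ∸ b)) (+-∸-assoc (N ∸ b) x≤y) ⟩
    ((N ∸ b) + (b ∸ a)) ∸ (N ∸ b) ≡⟨ m+n∸m≡n (N ∸ b) (b ∸ a) ⟩
    b ∸ a                         ∎
    where
    open ≡-Reasoning
    N a b : ℕ
    N = bound L
    a = pos L x
    b = pos L y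
    b≤N : b ≤ N
    b≤N = <⇒≤ (pos<bound L y)

  between-reflect⁺ : ∀ {a b x} → Between L a b x → Between (reflect L) b a x
  between-reflect⁺ (ax , xb) = reflect-<⁺ xb , reflect-<⁺ ax

  between-reflect⁻ : ∀ {a b x} → Between (reflect L) b a x → Between L a b x
  between-reflect⁻ {a} {b} {x} (bx , xa) = reflect-<⁻ {x} {a} xa , reflect-<⁻ {b} {x} bx

module Drawing {n : ℕ} (G : Graph n) where

  open Paths G

  NonCrossing : Layout n → Set
  NonCrossing L = ∀ {a b c d} → Adj G a b → Adj G c d →
                  ¬ (pos L a < pos L c × pos L c < pos L b × pos L b < pos L d)

  crossing⇒separates : ∀ {L : Layout n} {a b c d} →
                       pos L a < pos L c → pos L c < pos L b → pos L b < pos L d → Separates L a b c d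
  crossing⇒separates ac cb bd = x<y<z ac cb , z<x<y (<-trans ac cb) bd

  module _ {L : Layout n} (planar : NonCrossing L) where

    edges-not-separated : ∀ {a b c d} → Adj G a b → Adj G c d → ¬ Separates L a b c d
    edges-not-separated ab cd (x<y<z ac cb , x<y<z bd da) = <-asym (<-trans ac cb) (<-trans bd da)
    edges-not-separated ab cd (x<y<z ac cb , y<z<x da _)  = planar (Adj-sym cd) ab (da , ac , cb)
    edges-not-separated ab cd (x<y<z ac cb , z<x<y _ bd)  = planar ab cd (ac , cb , bd)
    edges-not-separated ab cd (y<z<x cb ba , x<y<z bd da) = planar cd (Adj-sym ab) (cb , bd , da)
    edges-not-separated ab cd (y<z<x _ ba  , y<z<x _ ab′) = <-asym ba ab′
    edges-not-separated ab cd (y<z<x _ ba  , z<x<y ab′ _) = <-asym ba ab′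
    edges-not-separated ab cd (z<x<y ba ac , x<y<z bd da) = planar (Adj-sym ab) (Adj-sym cd) (bd , da , ac)
    edges-not-separated ab cd (z<x<y ba _  , y<z<x _ ab′) = <-asym ba ab′
    edges-not-separated ab cd (z<x<y ba _  , z<x<y ab′ _) = <-asym ba ab′

    rotate-noncrossing : ∀ r → NonCrossing (rotate L r)
    rotate-noncrossing r ab cd (ac , cb , bd) =
      edges-not-separated ab cd (separates-rotate⁻ (crossing⇒separates ac cb bd))

    reflect-noncrossing : NonCrossing (reflect L)
    reflect-noncrossing {a} {b} {c} {d} ab cd (ac , cb , bd) = planar (Adj-sym cd) (Adj-sym ab)
      (reflect-<⁻ {L = L} {b} {d} bd , reflect-<⁻ {L = L} {c} {b} cb , reflect-<⁻ {L = L} {a} {c} ac)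

    chord-interior-closed : ∀ {a b c d} → Adj G a b → Adj G c d →
                            Between L a b c → d ≢ a → d ≢ b → Between L a b d
    chord-interior-closed {a} {b} {d = d} ab cd (ac , cb) d≢a d≢b with compare {L = L} d a
    ... | inj₁ da = ⊥-elim (planar (Adj-sym cd) ab (da , ac , cb))
    ... | inj₂ (inj₁ d≡a) = ⊥-elim (d≢a d≡a)
    ... | inj₂ (inj₂ ad) with compare {L = L} d b
    ...   | inj₁ db = ad , db
    ...   | inj₂ (inj₁ d≡b) = ⊥-elim (d≢b d≡b)
    ...   | inj₂ (inj₂ bd) = ⊥-elim (planar ab cd (ac , cb , bd))

    -- A path of X entering the interval (b, d) by an edge ss′ would trap the Y-path
    -- from b to d inside the chord ss′.
    no-interleaving : ∀ {X Y : Subset n} → ConnectedOn G X → ConnectedOn G Y → (∀ {x} → x ∈ X → x ∉ Y) →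
                      ∀ {a b c d} → a ∈ X → b ∈ Y → c ∈ X → d ∈ Y →
                      ¬ (pos L a < pos L b × pos L b < pos L c × pos L c < pos L d)
    no-interleaving {Y = Y} X-conn Y-conn disjoint {a} {b} {c} {d} a∈X b∈Y c∈X d∈Y (ab , bc , cd)
      with first-entry (λ z → (pos L b <? pos L z) ×-dec (pos L z <? pos L d))
                       (X-conn a c a∈X c∈X) (λ (ba , _) → <-asym ab ba) (bc , cd)
    ... | s , s′ , a→s , ss′ , (bs′ , s′d) , s′∈X with target a→s
    ...   | s∈X , s∉bd with compare {L = L} s b
    ...     | inj₂ (inj₁ refl) = disjoint s∈X b∈Y
    ...     | inj₁ sb = <-asym s′d (proj₂ (propagate-target (Y-conn b d b∈Y d∈Y) (sb , bs′) trapped))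
      where
      trapped : ∀ {u v} → Between L s s′ u → u ∈ Y → Adj G u v → v ∈ Y → Between L s s′ v
      trapped inside _ uv v∈Y = chord-interior-closed ss′ uv inside
        (λ { refl → disjoint s∈X v∈Y }) (λ { refl → disjoint s′∈X v∈Y })
    ...     | inj₂ (inj₂ bs) with compare {L = L} s d
    ...       | inj₂ (inj₁ refl) = disjoint s∈X d∈Y
    ...       | inj₁ sd = s∉bd (bs , sd)
    ...       | inj₂ (inj₂ ds) =
      <-asym bs′ (proj₁ (propagate-target (Path.reverse (Y-conn b d b∈Y d∈Y)) (s′d , ds) trapped))
      where
      trapped : ∀ {u v} → Between L s′ s u → u ∈ Y → Adj G u v → v ∈ Y → Between L s′ s v
      trapped inside _ uv v∈Y = chord-interior-closed (Adj-sym ss′) uv inside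
        (λ { refl → disjoint s′∈X v∈Y }) (λ { refl → disjoint s∈X v∈Y })

  outerplanar-layout : Outerplanar G → Σ (Layout n) NonCrossing
  outerplanar-layout (π , no-crossing) = L , λ ab cd → no-crossing _ _ _ _ ab cd
    where
    L : Layout n
    L = record { pos = λ x → toℕ (π ⟨$⟩ʳ x) ; bound = n ; pos<bound = λ x → toℕ<n (π ⟨$⟩ʳ x)
               ; pos-injective = Injection.injective (↔⇒↣ π) ∘ toℕ-injective }

record CoveringTrees {n : ℕ} (G : Graph n) (X Y : Subset n) : Set where
  field
    disjoint    : ∀ {x} → x ∈ X → x ∉ Y
    cover       : ∀ x → x ∈ X ⊎ x ∈ Y
    X-acyclic   : ¬ CycleIn G X
    Y-acyclic   : ¬ CycleIn G Y
    X-connected : ConnectedOn G X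
    Y-connected : ConnectedOn G Y

swap-trees : ∀ {n} {G : Graph n} {X Y} → CoveringTrees G X Y → CoveringTrees G Y X
swap-trees ct = record
  { disjoint = λ y∈Y y∈X → disjoint y∈X y∈Y ; cover = swap ∘ cover
  ; X-acyclic = Y-acyclic ; Y-acyclic = X-acyclic ; X-connected = Y-connected ; Y-connected = X-connected }
  where open CoveringTrees ct

covering-trees : ∀ {n} {G : Graph n} {T1 T2} → DoubleTree G T1 T2 → CoveringTrees G T1 T2
covering-trees (_ , _ , _ , disjoint , cover , (_ , T1-connected , T1-acyclic) , (_ , T2-connected , T2-acyclic)) =
  record { disjoint = λ {x} → disjoint x ; cover = cover
         ; X-acyclic = T1-acyclic ; Y-acyclic = T2-acyclic
         ; X-connected = T1-connected ; Y-connected = T2-connected }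

SameTree : ∀ {n} → Subset n → Subset n → Fin n × Fin n → Set
SameTree X Y (u , w) = (u ∈ X × w ∈ X) ⊎ (u ∈ Y × w ∈ Y)

module _ {n} {G : Graph n} {X Y : Subset n} (trees : CoveringTrees G X Y) where

  open CoveringTrees trees

  same-tree⇒⇔ : ∀ {u w} → SameTree X Y (u , w) → u ∈ X ⇔ w ∈ X
  same-tree⇒⇔ (inj₁ (u∈X , w∈X)) = mk⇔ (λ _ → w∈X) (λ _ → u∈X)
  same-tree⇒⇔ (inj₂ (u∈Y , w∈Y)) =
    mk⇔ (λ u∈X → ⊥-elim (disjoint u∈X u∈Y)) (λ w∈X → ⊥-elim (disjoint w∈X w∈Y))

  pair-meets : ∀ {v u x} → v ∈ X → u ∈ Y → x ≡ v ⊎ x ≡ u → x ∈ X → x ≡ v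
  pair-meets _   _   (inj₁ x≡v) _   = x≡v
  pair-meets _   u∈Y (inj₂ refl) u∈X = ⊥-elim (disjoint u∈X u∈Y)

module Regions {n : ℕ} (G : Graph n) where

  open Paths G
  open Acyclicity G
  open Forcing G
  open Drawing G

  TreeForce : Subset n → Subset n → Subset n → Set
  TreeForce X Y B = ForceWithin B X ⊎ ForceWithin B Y

  Sealed : Layout n → Fin n → Fin n → Set
  Sealed L p q = ∀ {c d} → Adj G c d → Between L p q c → Between L p q d ⊎ d ≡ p ⊎ d ≡ q

  module _ (B : Subset n) where

    RegionForce : ℕ → Set
    RegionForce k = ∀ (L : Layout n) → NonCrossing L → ∀ {X Y} → CoveringTrees G X Y →
      ∀ {p q} → p ∈ X → q ∈ Y → p ∈ B → q ∈ B → pos L q ∸ pos L p < k → Sealed L p q →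
      ∀ {w} → w ∉ B → Between L p q w → TreeForce X Y B

    module NoInnerXNeighbour {k : ℕ} (recurse : RegionForce k) (L : Layout n) (planar : NonCrossing L)
             {X Y} (trees : CoveringTrees G X Y) {p q} (p∈X : p ∈ X) (q∈Y : q ∈ Y) (p∈B : p ∈ B) (q∈B : q ∈ B)
             (width : pos L q ∸ pos L p < suc k) (sealed : Sealed L p q)
             (no-X-neighbour : ∀ {t} → Between L p q t → t ∈ X → ¬ Adj G q t) where

      open CoveringTrees trees

      white-closed : WhiteClosed B (Between L p q)
      white-closed c-in _ cd d∉B with sealed cd c-in
      ... | inj₁ d-in        = d-in
      ... | inj₂ (inj₁ refl) = ⊥-elim (d∉B p∈B)
      ... | inj₂ (inj₂ refl) = ⊥-elim (d∉B q∈B)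

      InnerYNeighbour : Fin n → Set
      InnerYNeighbour y = Between L p q y × y ∈ Y × Adj G q y

      inside⊆X : (∀ {y} → ¬ InnerYNeighbour y) → ∀ {c} → Between L p q c → c ∈ X
      inside⊆X none {c} c-in with cover c
      ... | inj₁ c∈X = c∈X
      ... | inj₂ c∈Y with first-exit (Y-connected c q c∈Y q∈Y) c-in (λ c-in _ cd _ → sealed cd c-in)
      ...   | inj₁ c→q = ⊥-elim (<-irrefl refl (proj₂ (proj₂ (target c→q))))
      ...   | inj₂ (_ , _ , _ , _ , inj₁ refl , p∈Y) = ⊥-elim (disjoint p∈X p∈Y)
      ...   | inj₂ (_ , _ , c→c′ , c′q , inj₂ refl , _) =
              ⊥-elim (none (proj₂ (target c→c′) , proj₁ (target c→c′) , Adj-sym c′q))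

      module Leftmost {y} (y-in : Between L p q y) (y∈Y : y ∈ Y) (qy : Adj G q y)
                      (leftmost : ∀ {z} → InnerYNeighbour z → pos L y ≤ pos L z) where

        right⊆Y : ∀ {c} → Between L y q c → c ∈ Y
        right⊆Y {c} (yc , cq) with cover c
        ... | inj₂ c∈Y = c∈Y
        ... | inj₁ c∈X = ⊥-elim (no-interleaving {L = L} planar X-connected Y-connected disjoint
                                   p∈X y∈Y c∈X q∈Y (proj₁ y-in , yc , cq))

        right-closed : ∀ {c d} → Between L y q c → Adj G c d → d ≢ p → d ≢ q → Between L y q d ⊎ d ≡ y
        right-closed {d = d} (yc , cq) cd d≢p d≢q with sealed cd (<-trans (proj₁ y-in) yc , cq)
        ... | inj₂ (inj₁ d≡p) = ⊥-elim (d≢p d≡p)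
        ... | inj₂ (inj₂ d≡q) = ⊥-elim (d≢q d≡q)
        ... | inj₁ (_ , dq) with compare {L = L} d y
        ...   | inj₁ dy          = ⊥-elim (planar (Adj-sym cd) (Adj-sym qy) (dy , yc , cq))
        ...   | inj₂ (inj₁ d≡y)  = inj₂ d≡y
        ...   | inj₂ (inj₂ yd)   = inj₁ (yd , dq)

        white-right-closed : y ∈ B → WhiteClosed B (Between L y q)
        white-right-closed y∈B c-in _ cd d∉B
          with right-closed c-in cd (black≢white p∈B d∉B) (black≢white q∈B d∉B)
        ... | inj₁ d-in = d-in
        ... | inj₂ refl = ⊥-elim (d∉B y∈B)

        -- a second white neighbour of q in the white component of y would lie to the right
        -- of y, and the white path back to y would stay to the right of y until it reaches y
        q-forces-y : y ∉ B → Force G B q y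
        q-forces-y y∉B = q∈B , y∉B , qy , unique
          where
          unique : ∀ w′ → Adj G q w′ → w′ ∉ B → WhiteConn G B y w′ → w′ ≡ y
          unique w′ qw′ w′∉B y→w′ with w′ ≟ y
          ... | yes w′≡y = w′≡y
          ... | no w′≢y = ⊥-elim (no-bypass Y-acyclic q∈Y w′≢y qw′ qy w′→y)
            where
            w′-in : Between L p q w′
            w′-in = propagate-target y→w′ y-in (λ c-in c∉B cd d∉B → white-closed c-in c∉B cd d∉B)
            w′∈Y : w′ ∈ Y
            w′∈Y with cover w′
            ... | inj₁ w′∈X = ⊥-elim (no-X-neighbour w′-in w′∈X qw′)
            ... | inj₂ w′∈Y = w′∈Y
            y<w′ : pos L y < pos L w′
            y<w′ = ≤∧≢⇒< (leftmost (w′-in , w′∈Y , qw′)) (w′≢y ∘ sym ∘ pos-injective L)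
            stays-right : ∀ {c d} → Between L y q c → c ∉ B → Adj G c d → d ∉ B → Between L y q d ⊎ d ≡ y
            stays-right c-in _ cd d∉B = right-closed c-in cd (black≢white p∈B d∉B) (black≢white q∈B d∉B)
            w′→y : PathIn G (λ v → v ∈ Y × v ≢ q) w′ y
            w′→y with first-exit (Path.reverse y→w′) (y<w′ , proj₂ w′-in) stays-right
            ... | inj₁ w′→y-right = ⊥-elim (<-irrefl refl (proj₁ (proj₂ (target w′→y-right))))
            ... | inj₂ (_ , _ , w′→c , cy , refl , _) =
                  Path.map (λ (v∉B , v-in) → right⊆Y v-in , black≢white q∈B v∉B) w′→c
                    Path.∷ʳ (cy , y∈Y , black≢white q∈B y∉B)

        sealed-left : Sealed L p y
        sealed-left {c} {d} cd (pc , cy) with sealed cd (pc , <-trans cy (proj₂ y-in))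
        ... | inj₂ (inj₁ d≡p) = inj₂ (inj₁ d≡p)
        ... | inj₂ (inj₂ refl) with cover c
        ...   | inj₁ c∈X = ⊥-elim (no-X-neighbour (pc , <-trans cy (proj₂ y-in)) c∈X (Adj-sym cd))
        ...   | inj₂ c∈Y = ⊥-elim (<⇒≱ cy (leftmost ((pc , <-trans cy (proj₂ y-in)) , c∈Y , Adj-sym cd)))
        sealed-left {c} {d} cd (pc , cy) | inj₁ (pd , dq) with compare {L = L} d y
        ... | inj₁ dy         = inj₁ (pd , dy)
        ... | inj₂ (inj₁ d≡y) = inj₂ (inj₂ d≡y)
        ... | inj₂ (inj₂ yd)  = ⊥-elim (planar cd (Adj-sym qy) (cy , yd , dq))

        narrower : pos L y ∸ pos L p < k
        narrower = <-≤-trans (∸-monoˡ-< (proj₂ y-in) (<⇒≤ (proj₁ y-in))) (≤-pred width)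

        force : ∀ {w} → w ∉ B → Between L p q w → TreeForce X Y B
        force {w} w∉B w-in with y ∈? B
        ... | no y∉B = inj₂ (q , y , q-forces-y y∉B , q∈Y , y∈Y)
        ... | yes y∈B with compare {L = L} w y
        ...   | inj₂ (inj₁ refl) = ⊥-elim (w∉B y∈B)
        ...   | inj₂ (inj₂ yw) = inj₂ (trapped-white⇒force Y-acyclic Y-connected right⊆Y (white-right-closed y∈B)
                                        w∉B (yw , proj₂ w-in) q∈B q∈Y)
        ...   | inj₁ wy = recurse L planar trees p∈X y∈Y p∈B y∈B narrower sealed-left w∉B (proj₁ w-in , wy)

      force : ∀ {w} → w ∉ B → Between L p q w → TreeForce X Y B
      force w∉B w-in with any? (λ y → between? L p q y ×-dec (y ∈? Y) ×-dec Adj? q y)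
      ... | no none = inj₁ (trapped-white⇒force X-acyclic X-connected (inside⊆X (λ iy → none (_ , iy)))
                                                  white-closed w∉B w-in p∈B p∈X)
      ... | yes (y₀ , inner₀) with minimiser (λ y → between? L p q y ×-dec (y ∈? Y) ×-dec Adj? q y) (pos L) inner₀
      ...   | y , (y-in , y∈Y , qy) , leftmost = Leftmost.force y-in y∈Y qy leftmost w∉B w-in

    region-force : ∀ k → RegionForce k
    region-force (suc k) L planar {X} {Y} trees {p} {q} p∈X q∈Y p∈B q∈B width sealed w∉B w-in
      with any? (λ t → between? L p q t ×-dec (t ∈? X) ×-dec Adj? q t)
    ... | no none = NoInnerXNeighbour.force (region-force k) L planar trees p∈X q∈Y p∈B q∈B width sealed
                      (λ t-in t∈X qt → none (_ , t-in , t∈X , qt)) w∉B w-in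
    ... | yes (t , (pt , tq) , t∈X , qt) =
          swap (NoInnerXNeighbour.force (region-force k) (reflect L) (reflect-noncrossing {L = L} planar) (swap-trees trees)
                  q∈Y p∈X q∈B p∈B width′ sealed′ no-Y-neighbour w∉B (between-reflect⁺ {L = L} w-in))
      where
      open CoveringTrees trees
      width′ : pos (reflect L) p ∸ pos (reflect L) q < suc k
      width′ = subst (_< suc k) (sym (reflect-distance {L = L} (<⇒≤ (<-trans (proj₁ w-in) (proj₂ w-in))))) width
      sealed′ : Sealed (reflect L) q p
      sealed′ cd c-in with sealed cd (between-reflect⁻ {L = L} c-in)
      ... | inj₁ d-in       = inj₁ (between-reflect⁺ {L = L} d-in)
      ... | inj₂ (inj₁ d≡p) = inj₂ (inj₂ d≡p)
      ... | inj₂ (inj₂ d≡q) = inj₂ (inj₁ d≡q)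
      -- an inner Y-neighbour s of p would make the chords ps and tq cross
      no-Y-neighbour : ∀ {s} → Between (reflect L) q p s → s ∈ Y → ¬ Adj G p s
      no-Y-neighbour {s} s-in s∈Y ps with between-reflect⁻ {L = L} s-in
      ... | ps′ , sq with compare {L = L} t s
      ...   | inj₁ ts           = planar ps (Adj-sym qt) (pt , ts , sq)
      ...   | inj₂ (inj₁ refl)  = disjoint t∈X s∈Y
      ...   | inj₂ (inj₂ st)    = no-interleaving {L = L} planar X-connected Y-connected disjoint
                                    p∈X s∈Y t∈X q∈Y (ps′ , st , tq)

module DoubleTreeForcing {n : ℕ} (G : Graph n) (connected : Connected G)
                         (L₀ : Layout n) (planar₀ : Drawing.NonCrossing G L₀) {T1 T2 : Subset n} (trees : CoveringTrees G T1 T2) (T2-nonempty : Nonempty T2) where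

  open Paths G
  open Acyclicity G
  open Forcing G
  open Drawing G
  open Regions G
  open CoveringTrees trees

  T1≢T2 : ∀ {a b} → a ∈ T1 → b ∈ T2 → a ≢ b
  T1≢T2 a∈T1 b∈T2 refl = disjoint a∈T1 b∈T2

  CrossedOnlyInT1 Unseparated : Fin n → Fin n → Set
  CrossedOnlyInT1 p q = ∀ {c d} → Adj G c d → Separates L₀ p q c d → c ∈ T1 × d ∈ T1
  Unseparated p q = ∀ {c d} → Adj G c d → ¬ Separates L₀ p q c d

  unseparated-sym : ∀ {p q} → Unseparated p q → Unseparated q p
  unseparated-sym unsep cd = unsep (Adj-sym cd) ∘ separates-sym

  unseparated⇒sealed : ∀ r {p q} → Unseparated p q → Sealed (rotate L₀ r) p q
  unseparated⇒sealed r {p} {q} unsep {d = d} cd (pc , cq) with compare {L = rotate L₀ r} d p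
  ... | inj₁ dp         = ⊥-elim (unsep cd (separates-rotate⁻ (x<y<z pc cq , y<z<x dp (<-trans pc cq))))
  ... | inj₂ (inj₁ d≡p) = inj₂ (inj₁ d≡p)
  ... | inj₂ (inj₂ pd) with compare {L = rotate L₀ r} d q
  ...   | inj₁ dq         = inj₁ (pd , dq)
  ...   | inj₂ (inj₁ d≡q) = inj₂ (inj₂ d≡q)
  ...   | inj₂ (inj₂ qd)  = ⊥-elim (unsep cd (separates-rotate⁻ (x<y<z pc cq , z<x<y (<-trans pc cq) qd)))

  unseparated⇒force : ∀ {B p q} → p ∈ T1 → q ∈ T2 → p ∈ B → q ∈ B → Unseparated p q →
                      ∀ {w} → w ∉ B → TreeForce T1 T2 B
  unseparated⇒force p∈T1 q∈T2 p∈B q∈B unsep w∉B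
    with arc-split L₀ (T1≢T2 p∈T1 q∈T2 ∘ sym) (black≢white p∈B w∉B) (black≢white q∈B w∉B)
  ... | inj₁ w-in = region-force _ _ (rotate L₀ _) (rotate-noncrossing planar₀ _) trees
                      p∈T1 q∈T2 p∈B q∈B (n<1+n _) (unseparated⇒sealed _ unsep) w∉B w-in
  ... | inj₂ w-in = swap (region-force _ _ (rotate L₀ _) (rotate-noncrossing planar₀ _) (swap-trees trees)
                      q∈T2 p∈T1 q∈B p∈B (n<1+n _) (unseparated⇒sealed _ (unseparated-sym unsep)) w∉B w-in)

  module Crossing {B : Subset n} {p q : Fin n} (p∈T1 : p ∈ T1) (q∈T2 : q ∈ T2) (p∈B : p ∈ B) (q∈B : q ∈ B)
                  (crossed : CrossedOnlyInT1 p q) where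

    Lq : Layout n
    Lq = rotate L₀ q

    planar : NonCrossing Lq
    planar = rotate-noncrossing planar₀ q

    OuterNeighbour : Fin n → Fin n → Set
    OuterNeighbour s t = Adj G s t × pos Lq p < pos Lq t

    outerNeighbour? : ∀ s t → Dec (OuterNeighbour s t)
    outerNeighbour? s t = Adj? s t ×-dec (pos Lq p <? pos Lq t)

    CrossingEnd : Fin n → Set
    CrossingEnd s = Between Lq q p s × ∃ (OuterNeighbour s)

    crossingEnd? : ∀ s → Dec (CrossingEnd s)
    crossingEnd? s = between? Lq q p s ×-dec any? (outerNeighbour? s)

    unseparated-if-uncrossed : (∀ {s} → ¬ CrossingEnd s) → Unseparated p q
    unseparated-if-uncrossed uncrossed cd sep with separates-from-first (rotate-first L₀ q) (separates-rotate⁺ sep)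
    ... | d-in , pc = uncrossed (d-in , _ , Adj-sym cd , pc)

    module Outermost {s t} (s-in : Between Lq q p s) (st : Adj G s t) (pt : pos Lq p < pos Lq t)
                     (leftmost : ∀ {s′} → CrossingEnd s′ → pos Lq s ≤ pos Lq s′)
                     (rightmost : ∀ {t′} → OuterNeighbour s t′ → pos Lq t′ ≤ pos Lq t) where

      t∈T1×s∈T1 : t ∈ T1 × s ∈ T1
      t∈T1×s∈T1 = crossed (Adj-sym st) (separates-rotate⁻ (separates-from-positions (proj₁ s-in) (proj₂ s-in) pt))

      s∈T1 : s ∈ T1
      s∈T1 = proj₂ t∈T1×s∈T1

      t∈T1 : t ∈ T1
      t∈T1 = proj₁ t∈T1×s∈T1

      unseparated-s : Unseparated s q
      unseparated-s {c} cd sep with separates-from-first (rotate-first L₀ q) (separates-rotate⁺ sep)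
      ... | (qd , ds) , sc with pos Lq c <? pos Lq t
      ...   | yes ct = planar (Adj-sym cd) st (ds , sc , ct)
      ...   | no ¬ct =
              <⇒≱ ds (leftmost ((qd , <-trans ds (proj₂ s-in)) , c , Adj-sym cd , <-≤-trans pt (≮⇒≥ ¬ct)))

      unseparated-t : Unseparated t q
      unseparated-t {c} {d} cd sep with separates-from-first (rotate-first L₀ q) (separates-rotate⁺ sep)
      ... | (qd , dt) , tc with compare {L = Lq} d s
      ...   | inj₁ ds          = <⇒≱ ds (leftmost ((qd , <-trans ds (proj₂ s-in)) , c , Adj-sym cd , <-trans pt tc))
      ...   | inj₂ (inj₁ refl) = <⇒≱ tc (rightmost (Adj-sym cd , <-trans pt tc))
      ...   | inj₂ (inj₂ sd)   = planar st (Adj-sym cd) (sd , dt , tc)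

      Pocket : Fin n → Set
      Pocket v = Between Lq s t v ⊎ v ≡ s ⊎ v ≡ t

      pocket? : ∀ v → Dec (Pocket v)
      pocket? v = between? Lq s t v ⊎-dec (v ≟ s) ⊎-dec (v ≟ t)

      inner-neighbour : ∀ {c d} → Between Lq s t c → Adj G c d → Pocket d
      inner-neighbour c-in cd with _ ≟ s | _ ≟ t
      ... | yes d≡s | _       = inj₂ (inj₁ d≡s)
      ... | no _    | yes d≡t = inj₂ (inj₂ d≡t)
      ... | no d≢s  | no d≢t  = inj₁ (chord-interior-closed {L = Lq} planar st cd c-in d≢s d≢t)

      -- a T2-path from an inner vertex to q could never leave the chord st
      pocket⊆T1 : ∀ {v} → Pocket v → v ∈ T1
      pocket⊆T1 (inj₂ (inj₁ refl)) = s∈T1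
      pocket⊆T1 (inj₂ (inj₂ refl)) = t∈T1
      pocket⊆T1 {v} (inj₁ v-in) with cover v
      ... | inj₁ v∈T1 = v∈T1
      ... | inj₂ v∈T2 = ⊥-elim (<-asym (proj₁ s-in) (proj₁ (propagate-target (Y-connected v q v∈T2 q∈T2) v-in
            (λ c-in _ cd d∈T2 → chord-interior-closed {L = Lq} planar st cd c-in
               (T1≢T2 s∈T1 d∈T2 ∘ sym) (T1≢T2 t∈T1 d∈T2 ∘ sym)))))

      exits-at-end : ∀ {c e} → Pocket c → Adj G c e → ¬ Pocket e → c ≡ s ⊎ c ≡ t
      exits-at-end (inj₁ c-in) ce ¬e-in = ⊥-elim (¬e-in (inner-neighbour c-in ce))
      exits-at-end (inj₂ c-end)  _  _     = c-end

      ends-joined : ∀ {c c′} → c ≡ s ⊎ c ≡ t → c′ ≡ s ⊎ c′ ≡ t → c ≡ c′ ⊎ Adj G c c′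
      ends-joined (inj₁ refl) (inj₁ refl) = inj₁ refl
      ends-joined (inj₁ refl) (inj₂ refl) = inj₂ st
      ends-joined (inj₂ refl) (inj₁ refl) = inj₂ (Adj-sym st)
      ends-joined (inj₂ refl) (inj₂ refl) = inj₁ refl

      module WhiteEnds (s∉B : s ∉ B) (t∉B : t ∉ B) where

        -- a white path may leave the pocket only through s or t, which are adjacent
        shortcut : ∀ {y w′} → Pocket y → PathIn G (_∉ B) y w′ → Pocket w′ →
                   PathIn G (λ v → v ∉ B × Pocket v) y w′
        shortcut y-in y→w′ w′-in with first-exit y→w′ y-in (λ {_} {d} _ _ _ _ → toSum (pocket? d))
        ... | inj₁ inside = inside
        ... | inj₂ (c , _ , y→c , ce , ¬e-in , _)
          with first-exit (Path.reverse y→w′) w′-in (λ {_} {d} _ _ _ _ → toSum (pocket? d))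
        ...   | inj₁ inside = Path.reverse inside
        ...   | inj₂ (c′ , _ , w′→c′ , c′e′ , ¬e′-in , _)
          with ends-joined (exits-at-end (proj₂ (target y→c)) ce ¬e-in)
                           (exits-at-end (proj₂ (target w′→c′)) c′e′ ¬e′-in)
        ...     | inj₁ refl = y→c Path.++ Path.reverse w′→c′
        ...     | inj₂ cc′  = (y→c Path.∷ʳ (cc′ , target w′→c′)) Path.++ Path.reverse w′→c′

        black-inner : ∀ {x} → Pocket x → x ∈ B → Between Lq s t x
        black-inner (inj₁ x-in)        _   = x-in
        black-inner (inj₂ (inj₁ refl)) s∈B = ⊥-elim (s∉B s∈B)
        black-inner (inj₂ (inj₂ refl)) t∈B = ⊥-elim (t∉B t∈B)

        -- the last black vertex on a T1-path from p out of the chord st forces into the pocket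
        pocket-force : ForceWithin B T1
        pocket-force
          with first-exit (X-connected p s p∈T1 s∈T1) (proj₂ s-in , pt) (λ c-in _ cd _ → inner-neighbour c-in cd)
        ... | inj₁ p→s = ⊥-elim (<-irrefl refl (proj₁ (proj₂ (target p→s))))
        ... | inj₂ (c , e , p→c , ce , e-end , e∈T1)
          with last-exit (_∈? B)
                         (Path.map (λ (v∈T1 , v-in) → v∈T1 , inj₁ v-in) p→c Path.∷ʳ (ce , e∈T1 , inj₂ e-end))
                         p∈B ([ (λ { refl → s∉B }) , (λ { refl → t∉B }) ]′ e-end)
        ...   | x , y , x∈B , (x∈T1 , x-pocket) , xy , y→e = x , y , (x∈B , y∉B , xy , unique) , x∈T1 , y∈T1
          where
          y∉B : y ∉ B
          y∉B = proj₂ (source y→e)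
          y∈T1 : y ∈ T1
          y∈T1 = proj₁ (proj₁ (source y→e))
          x-in : Between Lq s t x
          x-in = black-inner x-pocket x∈B
          unique : ∀ w′ → Adj G x w′ → w′ ∉ B → WhiteConn G B y w′ → w′ ≡ y
          unique w′ xw′ w′∉B y→w′ with w′ ≟ y
          ... | yes w′≡y = w′≡y
          ... | no w′≢y = ⊥-elim (no-bypass X-acyclic x∈T1 (w′≢y ∘ sym) xy xw′
                  (Path.map (λ (v∉B , v-pocket) → pocket⊆T1 v-pocket , black≢white x∈B v∉B)
                            (shortcut (proj₂ (proj₁ (source y→e))) y→w′ (inner-neighbour x-in xw′))))

      force : ∀ {w} → w ∉ B → TreeForce T1 T2 B
      force w∉B with s ∈? B | t ∈? B
      ... | yes s∈B | _       = unseparated⇒force s∈T1 q∈T2 s∈B q∈B unseparated-s w∉B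
      ... | no _    | yes t∈B = unseparated⇒force t∈T1 q∈T2 t∈B q∈B unseparated-t w∉B
      ... | no s∉B  | no t∉B  = inj₁ (WhiteEnds.pocket-force s∉B t∉B)

    tree-force : ∀ {w} → w ∉ B → TreeForce T1 T2 B
    tree-force = choose (any? crossingEnd?)
      where
      choose : Dec (∃ CrossingEnd) → ∀ {w} → w ∉ B → TreeForce T1 T2 B
      choose (no uncrossed) =
        unseparated⇒force p∈T1 q∈T2 p∈B q∈B (unseparated-if-uncrossed (λ end → uncrossed (_ , end)))
      choose (yes (_ , end₀)) =
        let s , (s-in , _ , outer₀) , leftmost = minimiser crossingEnd? (pos Lq) end₀
            t , (st , pt) , rightmost         = maximiser (outerNeighbour? s) (pos Lq) outer₀
        in  Outermost.force s-in st pt leftmost rightmost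

  module Partner {v : Fin n} (v∈T1 : v ∈ T1) where

    Lv : Layout n
    Lv = rotate L₀ v

    planar : NonCrossing Lv
    planar = rotate-noncrossing planar₀ v

    LeftEnded RightEnded : Fin n → Set
    LeftEnded  d = d ∈ T2 × ∃ λ c → c ∈ T1 × Adj G c d × pos Lv c < pos Lv d
    RightEnded d = d ∈ T2 × ∃ λ c → c ∈ T1 × Adj G c d × pos Lv d < pos Lv c

    leftEnded? : ∀ d → Dec (LeftEnded d)
    leftEnded?  d = (d ∈? T2) ×-dec any? (λ c → (c ∈? T1) ×-dec Adj? c d ×-dec (pos Lv c <? pos Lv d))
    rightEnded? : ∀ d → Dec (RightEnded d)
    rightEnded? d = (d ∈? T2) ×-dec any? (λ c → (c ∈? T1) ×-dec Adj? c d ×-dec (pos Lv d <? pos Lv c))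

    crossedOnlyInT1⁺ : ∀ {u} →
                       (∀ {c d} → Adj G c d → Between Lv v u c → pos Lv u < pos Lv d → c ∈ T1 × d ∈ T1) →
                       CrossedOnlyInT1 v u
    crossedOnlyInT1⁺ check cd sep with separates-from-first (rotate-first L₀ v) (separates-sym (separates-rotate⁺ sep))
    ... | c-in , ud = check cd c-in ud

    rightmost-left-ended : ∀ {u} → LeftEnded u → (∀ {d} → LeftEnded d → pos Lv d ≤ pos Lv u) →
                           CrossedOnlyInT1 v u
    rightmost-left-ended {u} (u∈T2 , c₀ , c₀∈T1 , c₀u , c₀<u) rightmost = crossedOnlyInT1⁺ check
      where
      check : ∀ {c d} → Adj G c d → Between Lv v u c → pos Lv u < pos Lv d → c ∈ T1 × d ∈ T1
      check {c} {d} cd (vc , cu) ud with cover c | cover d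
      ... | inj₁ c∈T1 | inj₁ d∈T1 = c∈T1 , d∈T1
      ... | inj₁ c∈T1 | inj₂ d∈T2 = ⊥-elim (<⇒≱ ud (rightmost (d∈T2 , c , c∈T1 , cd , <-trans cu ud)))
      ... | inj₂ c∈T2 | _ with compare {L = Lv} c c₀
      ...   | inj₁ cc₀         = ⊥-elim (no-interleaving {L = Lv} planar X-connected Y-connected disjoint
                                            v∈T1 c∈T2 c₀∈T1 u∈T2 (vc , cc₀ , c₀<u))
      ...   | inj₂ (inj₁ refl) = ⊥-elim (disjoint c₀∈T1 c∈T2)
      ...   | inj₂ (inj₂ c₀c)  = ⊥-elim (planar c₀u cd (c₀c , cu , ud))

    leftmost-right-ended : ∀ {u} → RightEnded u → (∀ {d} → RightEnded d → pos Lv u ≤ pos Lv d) →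
                           (∀ {d} → ¬ LeftEnded d) → CrossedOnlyInT1 v u
    leftmost-right-ended {u} (u∈T2 , c₀ , c₀∈T1 , c₀u , u<c₀) leftmost no-left = crossedOnlyInT1⁺ check
      where
      check : ∀ {c d} → Adj G c d → Between Lv v u c → pos Lv u < pos Lv d → c ∈ T1 × d ∈ T1
      check {c} {d} cd (vc , cu) ud with cover c | cover d
      ... | inj₁ c∈T1 | inj₁ d∈T1 = c∈T1 , d∈T1
      ... | inj₁ c∈T1 | inj₂ d∈T2 = ⊥-elim (no-left (d∈T2 , c , c∈T1 , cd , <-trans cu ud))
      ... | inj₂ c∈T2 | inj₁ d∈T1 = ⊥-elim (<⇒≱ cu (leftmost (c∈T2 , d , d∈T1 , Adj-sym cd , <-trans cu ud)))
      ... | inj₂ c∈T2 | inj₂ d∈T2 with compare {L = Lv} d c₀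
      ...   | inj₁ dc₀         = ⊥-elim (planar cd (Adj-sym c₀u) (cu , ud , dc₀))
      ...   | inj₂ (inj₁ refl) = ⊥-elim (disjoint c₀∈T1 d∈T2)
      ...   | inj₂ (inj₂ c₀d)  = ⊥-elim (no-interleaving {L = Lv} planar X-connected Y-connected disjoint
                                            v∈T1 u∈T2 c₀∈T1 d∈T2 (<-trans vc cu , u<c₀ , c₀d))

    some-right-ended : (∀ {d} → ¬ LeftEnded d) → ∃ RightEnded
    some-right-ended no-left with first-entry (_∈? T2) (connected v _ ∈⊤ ∈⊤) (disjoint v∈T1) (proj₂ T2-nonempty)
    ... | c , d , v→c , cd , d∈T2 , _ with cover c | compare {L = Lv} c d
    ...   | inj₂ c∈T2 | _                = ⊥-elim (proj₂ (target v→c) c∈T2)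
    ...   | inj₁ c∈T1 | inj₁ cd<         = ⊥-elim (no-left (d∈T2 , c , c∈T1 , cd , cd<))
    ...   | inj₁ c∈T1 | inj₂ (inj₁ refl) = ⊥-elim (disjoint c∈T1 d∈T2)
    ...   | inj₁ c∈T1 | inj₂ (inj₂ dc)   = d , d∈T2 , c , c∈T1 , cd , dc

    partner : ∃ λ u → u ∈ T2 × CrossedOnlyInT1 v u
    partner = choose (any? leftEnded?)
      where
      choose : Dec (∃ LeftEnded) → ∃ λ u → u ∈ T2 × CrossedOnlyInT1 v u
      choose (yes (_ , left₀)) =
        let u , left , rightmost = maximiser leftEnded? (pos Lv) left₀
        in  u , proj₁ left , rightmost-left-ended left rightmost
      choose (no none-left) =
        let no-left : ∀ {d} → ¬ LeftEnded d
            no-left left = none-left (_ , left)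
            u , right , leftmost = minimiser rightEnded? (pos Lv) (proj₂ (some-right-ended no-left))
        in  u , proj₁ right , leftmost-right-ended right leftmost no-left

  open Partner using (partner)

  Anchored : Subset n → Set
  Anchored B = ∃₂ λ p q → p ∈ T1 × q ∈ T2 × p ∈ B × q ∈ B × CrossedOnlyInT1 p q

  anchored-run : ∀ {B} → Anchored B → ∃ λ fs → Run G B fs ⊤ × All (SameTree T1 T2) fs
  anchored-run = Greedy.complete-run grow tree-step
    where
    grow : ∀ {B} w → Anchored B → Anchored (B ∪ ⁅ w ⁆)
    grow w (p , q , p∈T1 , q∈T2 , p∈B , q∈B , crossed) =
      p , q , p∈T1 , q∈T2 , p⊆p∪q ⁅ w ⁆ p∈B , p⊆p∪q ⁅ w ⁆ q∈B , crossed
    tree-step : ∀ {B w} → Anchored B → w ∉ B → ∃₂ λ u v → Force G B u v × SameTree T1 T2 (u , v)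
    tree-step (p , q , p∈T1 , q∈T2 , p∈B , q∈B , crossed) w∉B
      with Crossing.tree-force p∈T1 q∈T2 p∈B q∈B crossed w∉B
    ... | inj₁ (u , v , f , u∈T1 , v∈T1) = u , v , f , inj₁ (u∈T1 , v∈T1)
    ... | inj₂ (u , v , f , u∈T2 , v∈T2) = u , v , f , inj₂ (u∈T2 , v∈T2)

  partner-run : ∀ {v} → v ∈ T1 →
                ∃ λ u → u ∈ T2 × ∃ λ fs → Run G (⁅ v ⁆ ∪ ⁅ u ⁆) fs ⊤ × All (SameTree T1 T2) fs
  partner-run {v} v∈T1 =
    let u , u∈T2 , crossed = partner v∈T1
    in  u , u∈T2 , anchored-run (v , u , v∈T1 , u∈T2 , p⊆p∪q ⁅ u ⁆ (x∈⁅x⁆ v) , q⊆p∪q ⁅ v ⁆ ⁅ u ⁆ (x∈⁅x⁆ u)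
                                , crossed)

  pzf-partner : ∀ v → v ∈ T1 → Σ (Fin n) λ u → u ∈ T2 × IsPZFSet G (⁅ u ⁆ ∪ ⁅ v ⁆)
  pzf-partner v v∈T1 =
    let u , u∈T2 , fs , run , _ = partner-run v∈T1
    in  u , u∈T2 , fs , subst (λ B → Run G B fs ⊤) (∪-comm ⁅ v ⁆ ⁅ u ⁆) run

  covering-forcing-trees : ∀ {v} → v ∈ T1 → Σ (Fin n) λ a → Σ (Fin n) λ b → a ≢ b × Σ _ λ fs →
                           Run G (⁅ a ⁆ ∪ ⁅ b ⁆) fs ⊤ × ForcingTreeIs G fs a T1 × ForcingTreeIs G fs b T2
  covering-forcing-trees {v} v∈T1 =
    let u , u∈T2 , fs , run , same = partner-run v∈T1
    in  v , u , T1≢T2 v∈T1 u∈T2 , fs , run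
      , ForcingTree.forcing-tree X-acyclic run v∈T1 (pair-meets trees v∈T1 u∈T2 ∘ ∈-⁅⁆∪⁅⁆⁻)
                                 (same-tree⇒⇔ trees ∘ lookup same)
      , ForcingTree.forcing-tree Y-acyclic run u∈T2
                                 (pair-meets (swap-trees trees) u∈T2 v∈T1 ∘ swap ∘ ∈-⁅⁆∪⁅⁆⁻)
                                 (same-tree⇒⇔ (swap-trees trees) ∘ swap ∘ lookup same)

corollary7p5 : ∀ {n : ℕ} (G : Graph n) (T1 T2 : Subset n) → DoubleTree G T1 T2 →
    (∀ v → v ∈ T1 → Σ (Fin n) λ u → u ∈ T2 × IsPZFSet G (⁅ u ⁆ ∪ ⁅ v ⁆))
    × (Σ (Fin n) λ a → Σ (Fin n) λ b → a ≢ b × Σ _ λ fs →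
    Run G (⁅ a ⁆ ∪ ⁅ b ⁆) fs ⊤ × ForcingTreeIs G fs a T1 × ForcingTreeIs G fs b T2)
corollary7p5 G T1 T2 dt@(connected , outerplanar , _ , _ , _ , ((v₀ , v₀∈T1) , _) , (T2-nonempty , _))
  with L₀ , planar₀ ← Drawing.outerplanar-layout G outerplanar
  = pzf-partner , covering-forcing-trees v₀∈T1
  where open DoubleTreeForcing G connected L₀ planar₀ (covering-trees dt) T2-nonempty
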